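{- Let $I$ be a well-ordered set, $\mu$ a limit ordinal, and $S$ a closed subset of $\prod_{i\in I}\{0,1\}$ such that for all $x\in S$ and $i\in I$, $x_i=1$ implies $i<\mu$. Then $$\operatorname{ev}_{S_\mu}(E(S_\mu))=\bigcup_{\mu'<\mu}\pi_{\mu'}^*\big(\operatorname{ev}_{S_{\mu'}}(E(S_{\mu'}))\big).$$
   Context: Write $X=\prod_{i\in I}\{0,1\}$ (product topology), $x_i$ the $i$-th coordinate; each $i\in I$ is identified with the ordinal that is the order type of $\{j\in I:j<i\}$. For $J\subseteq I$, $\pi_J:X\to X$ has $\pi_J(x)_i=x_i$ for $i\in J$ and $0$ otherwise, $S_J=\pi_J(S)$, and $\pi_J^*:C(S_J,\mathbb{Z})\to C(S,\mathbb{Z})$ is $f\mapsto f\circ\pi_J|_S$. For an ordinal $\nu$, $\pi_\nu=\pi_{\{i\in I:i<\nu\}}$ and $S_\nu=S_{\{i\in I:i<\nu\}}$ (note $S_\mu=S$). For $T\subseteq X$, $e_{T,i}\in C(T,\mathbb{Z})$ is $x\mapsto x_i$; $P$ is the set of finite strictly decreasing sequences in $I$ (including the empty one), ordered lexicographically (empty sequence smallest; compare first entries, and if equal compare tails); $\operatorname{ev}_T(i_1,\dots,i_r)=e_{T,i_1}\cdots e_{T,i_r}$; $E(T)=\{p\in P:\operatorname{ev}_T(p)\notin\operatorname{span}_{\mathbb{Z}}\operatorname{ev}_T(\{q\in P:q<p\})\}$. -}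

module Defs where

open import Level using (0ℓ)
open import Data.Bool using (Bool; true; false; if_then_else_; _∧_)
open import Data.Integer using (ℤ; 0ℤ; 1ℤ; _+_; _*_)
open import Data.List using (List; []; _∷_)
open import Data.List.Membership.Propositional using (_∈_)
open import Data.List.Relation.Unary.All using (All)
open import Data.Product using (Σ; ∃; _×_; _,_; proj₁; proj₂)
open import Data.Unit using (⊤)
open import Data.Empty using (⊥)
open import Relation.Nullary using (¬_; does)
open import Relation.Binary using (Rel; IsStrictTotalOrder)
open import Relation.Binary.PropositionalEquality using (_≡_)
open import Induction.WellFounded using (WellFounded)

record WellOrder : Set₁ where
  field
    Carrier : Set
    _<_     : Rel Carrier 0ℓ
    isSTO   : IsStrictTotalOrder _≡_ _<_
    wf      : WellFounded _<_
  open IsStrictTotalOrder isSTO public using (_<?_)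

open WellOrder public using (Carrier)

module Cube (I : WellOrder) where
  open WellOrder I using () renaming (_<_ to _<ᵢ_)

  X : Set
  X = Carrier I → Bool

  SubX : Set₁
  SubX = X → Set

  -- closed in the product topology: the complement is open, i.e. every point
  -- outside S has a basic cylinder neighbourhood (fixing finitely many
  -- coordinates) disjoint from S.
  Closed : SubX → Set
  Closed S = ∀ x → ¬ S x →
    Σ (List (Carrier I)) λ F → ∀ y → (∀ i → i ∈ F → y i ≡ x i) → ¬ S y

  π : (Carrier I → Bool) → X → X
  π J x i = J i ∧ x i

  img : (Carrier I → Bool) → SubX → SubX
  img J S y = ∃ λ x → S x × (∀ i → π J x i ≡ y i)

  e : Carrier I → X → ℤ
  e i x = if x i then 1ℤ else 0ℤ

  ev : List (Carrier I) → X → ℤ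
  ev []       x = 1ℤ
  ev (i ∷ is) x = e i x * ev is x

  Decreasing : List (Carrier I) → Set
  Decreasing []           = ⊤
  Decreasing (i ∷ [])     = ⊤
  Decreasing (i ∷ j ∷ is) = j <ᵢ i × Decreasing (j ∷ is)

  _<ₚ_ : List (Carrier I) → List (Carrier I) → Set
  []       <ₚ []       = ⊥
  []       <ₚ (_ ∷ _)  = ⊤
  (_ ∷ _)  <ₚ []       = ⊥
  (i ∷ is) <ₚ (j ∷ js) = (i <ᵢ j) Data.Sum.⊎ ((i ≡ j) × (is <ₚ js))
    where import Data.Sum

  linComb : List (ℤ × List (Carrier I)) → X → ℤ
  linComb []             x = 0ℤ
  linComb ((c , q) ∷ L)  x = c * ev q x + linComb L x

  -- ev_T(p) ∈ span_ℤ ev_T({q ∈ P : q < p})  (equality in C(T,ℤ): on points of T)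
  InSpanBelow : SubX → List (Carrier I) → Set
  InSpanBelow T p = ∃ λ (L : List (ℤ × List (Carrier I))) →
    All (λ cq → Decreasing (proj₂ cq) × (proj₂ cq <ₚ p)) L ×
    (∀ x → T x → ev p x ≡ linComb L x)

  E : SubX → List (Carrier I) → Set
  E T p = Decreasing p × ¬ InSpanBelow T p

  InEvE : SubX → (X → ℤ) → Set
  InEvE T f = ∃ λ p → E T p × (∀ x → T x → f x ≡ ev p x)

-- Ordinals: we fix a well-ordered set Ω (any well-order is isomorphic to an
-- ordinal) together with an order embedding ι : I → Ω whose image is
-- downward closed, so ι i is exactly the order type of {j ∈ I : j < i}.
module Ordinals (I Ω : WellOrder) (ι : Carrier I → Carrier Ω) where
  open Cube I
  open WellOrder Ω using () renaming (_<_ to _<Ω_; _<?_ to _<Ω?_)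
  open WellOrder I using () renaming (_<_ to _<ᵢ_)

  StrictMono : Set
  StrictMono = ∀ {i j} → i <ᵢ j → ι i <Ω ι j

  DownClosedImage : Set
  DownClosedImage = ∀ i ν → ν <Ω ι i → ∃ λ j → ι j ≡ ν

  -- limit ordinal: nonzero and not a successor
  IsLimit : Carrier Ω → Set
  IsLimit μ = (∃ λ a → a <Ω μ) × (∀ a → a <Ω μ → ∃ λ b → a <Ω b × b <Ω μ)

  below : Carrier Ω → Carrier I → Bool
  below ν i = does (ι i <Ω? ν)

  πν : Carrier Ω → X → X
  πν ν = π (below ν)

  Sν : Carrier Ω → SubX → SubX
  Sν ν = img (below ν)

{-# OPTIONS --safe #-}
-- A monomial with a coordinate outside J vanishes on S_J, so every
-- p ∈ E(S_ν) has all its coordinates below ν; for p ∈ E(S_μ), as μ is a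
-- limit, they even lie below some ν < μ.  Monomials q <ₚ p then also live
-- below ν, and points of S, S_ν and S_μ agreeing below ν give the same values
-- to all of them, so p ∈ E(S_ν) iff p ∈ E(S_μ).
module Submission where

open import Defs
open import Data.Bool using (Bool; true; false; if_then_else_)
open import Data.Bool.Properties using (∧-zeroʳ)
open import Data.Integer using (ℤ; 0ℤ; 1ℤ; _+_; _*_)
open import Data.Integer.Properties using (_≟_)
open import Data.List using (List; []; _∷_)
open import Data.List.Relation.Unary.All using (All; []; _∷_)
open import Data.Product using (∃; _×_; _,_; proj₂)
open import Data.Sum using (inj₁; inj₂)
open import Data.Empty using (⊥-elim)
open import Function using (_∘_; id)
open import Relation.Nullary using (¬_; yes; no)
open import Relation.Nullary.Decidable using (dec-true; decidable-stable)
open import Relation.Binary using (IsStrictTotalOrder)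
open import Relation.Binary.PropositionalEquality
  using (_≡_; _≗_; refl; sym; trans; cong; cong₂; module ≡-Reasoning)
open ≡-Reasoning

module CubeProperties (I : WellOrder) where
  open Cube I
  open WellOrder I using () renaming (_<_ to _<ᵢ_)

  DownClosed : (Carrier I → Set) → Set
  DownClosed P = ∀ {i j} → i <ᵢ j → P j → P i

  AgreeOn : (Carrier I → Set) → X → X → Set
  AgreeOn P x y = ∀ i → P i → x i ≡ y i

  Covers : (Carrier I → Set) → SubX → SubX → Set
  Covers P T T′ = ∀ y → T y → ∃ λ x → T′ x × AgreeOn P y x

  Covers-trans : ∀ {P T T′ T″} → Covers P T T′ → Covers P T′ T″ → Covers P T T″
  Covers-trans c c′ y Ty with c y Ty
  ... | x , T′x , y≈x with c′ x T′x
  ...   | z , T″z , x≈z = z , T″z , λ i Pi → trans (y≈x i Pi) (x≈z i Pi)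

  Decreasing-tail : ∀ i qs → Decreasing (i ∷ qs) → Decreasing qs
  Decreasing-tail i []       _       = _
  Decreasing-tail i (_ ∷ _)  (_ , d) = d

  Decreasing⇒All : ∀ {P} → DownClosed P →
    ∀ i qs → Decreasing (i ∷ qs) → P i → All P (i ∷ qs)
  Decreasing⇒All P↓ i []       _         Pi = Pi ∷ []
  Decreasing⇒All P↓ i (k ∷ ks) (k<i , d) Pi = Pi ∷ Decreasing⇒All P↓ k ks d (P↓ k<i Pi)

  <ₚ-All : ∀ {P} → DownClosed P →
    ∀ q p → Decreasing q → q <ₚ p → All P p → All P q
  <ₚ-All P↓ []       _        _ _                   _          = []
  <ₚ-All P↓ (i ∷ qs) (j ∷ ps) d (inj₁ i<j)          (Pj ∷ _)   =
    Decreasing⇒All P↓ i qs d (P↓ i<j Pj)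
  <ₚ-All P↓ (i ∷ qs) (i ∷ ps) d (inj₂ (refl , qs<ps)) (Pi ∷ Pps) =
    Pi ∷ <ₚ-All P↓ qs ps (Decreasing-tail i qs d) qs<ps Pps

  ev-cong : ∀ {P x y} q → All P q → AgreeOn P x y → ev q x ≡ ev q y
  ev-cong []      _          _   = refl
  ev-cong (i ∷ q) (Pi ∷ Pq) x≈y =
    cong₂ _*_ (cong (if_then 1ℤ else 0ℤ) (x≈y i Pi)) (ev-cong q Pq x≈y)

  LowerTerms : List (Carrier I) → List (ℤ × List (Carrier I)) → Set
  LowerTerms p = All (λ cq → Decreasing (proj₂ cq) × (proj₂ cq <ₚ p))

  linComb-cong : ∀ {P x y p} → DownClosed P → All P p →
    ∀ L → LowerTerms p L → AgreeOn P x y → linComb L x ≡ linComb L y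
  linComb-cong P↓ Pp []            _                 _   = refl
  linComb-cong {p = p} P↓ Pp ((c , q) ∷ L) ((d , q<p) ∷ low) x≈y =
    cong₂ _+_ (cong (c *_) (ev-cong q (<ₚ-All P↓ q p d q<p Pp) x≈y))
              (linComb-cong P↓ Pp L low x≈y)

  InSpanBelow-transfer : ∀ {P T T′ p} → DownClosed P → All P p →
    Covers P T T′ → InSpanBelow T′ p → InSpanBelow T p
  InSpanBelow-transfer {T = T} {p = p} P↓ Pp cov (L , low , ev≡) = L , low , ev≡′
    where
    ev≡′ : ∀ y → T y → ev p y ≡ linComb L y
    ev≡′ y Ty with cov y Ty
    ... | x , T′x , y≈x = begin
      ev p y        ≡⟨ ev-cong p Pp y≈x ⟩
      ev p x        ≡⟨ ev≡ x T′x ⟩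
      linComb L x   ≡⟨ linComb-cong P↓ Pp L low (λ i Pi → sym (y≈x i Pi)) ⟩
      linComb L y   ∎

  E-transfer : ∀ {P T T′ p} → DownClosed P → All P p →
    Covers P T T′ → E T p → E T′ p
  E-transfer P↓ Pp cov (d , ∉span) = d , λ ∈span → ∉span (InSpanBelow-transfer P↓ Pp cov ∈span)

  π-agree : ∀ {P : Carrier I → Set} J → (∀ i → P i → J i ≡ true) → ∀ x → AgreeOn P (π J x) x
  π-agree J P⊆J x i Pi rewrite P⊆J i Pi = refl

  img-covers : ∀ {P : Carrier I → Set} J S → (∀ i → P i → J i ≡ true) → Covers P (img J S) S
  img-covers J S P⊆J y (x , Sx , πx≗y) =
    x , Sx , λ i Pi → trans (sym (πx≗y i)) (π-agree J P⊆J x i Pi)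

  covers-img : ∀ {P : Carrier I → Set} J S → (∀ i → P i → J i ≡ true) → Covers P S (img J S)
  covers-img J S P⊆J x Sx = π J x , (x , Sx , λ _ → refl) , λ i Pi → sym (π-agree J P⊆J x i Pi)

  E-img-head : ∀ J S j ps → E (img J S) (j ∷ ps) → J j ≡ true
  E-img-head J S j ps (_ , ∉span) with J j in Jj
  ... | true  = refl
  ... | false = ⊥-elim (∉span ([] , [] , vanishes))
    where
    vanishes : ∀ y → img J S y → ev (j ∷ ps) y ≡ 0ℤ
    vanishes y (x , _ , πx≗y) rewrite sym (πx≗y j) | Jj = refl

  π-fixes-support : ∀ J x → (∀ i → x i ≡ true → J i ≡ true) → π J x ≗ x
  π-fixes-support J x supp i with x i in xi
  ... | false = ∧-zeroʳ (J i)
  ... | true  rewrite supp i xi = refl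

  Supported : (Carrier I → Bool) → SubX → Set
  Supported J S = ∀ x → S x → ∀ i → x i ≡ true → J i ≡ true

  Supported⇒⊆img : ∀ {J S} → Supported J S → ∀ x → S x → img J S x
  Supported⇒⊆img supp x Sx = x , Sx , π-fixes-support _ x (supp x Sx)

  Supported⇒img⊆≗ : ∀ {J S} → Supported J S → ∀ y → img J S y → ∃ λ x → S x × x ≗ y
  Supported⇒img⊆≗ {J} supp y (x , Sx , πx≗y) =
    x , Sx , λ i → trans (sym (π-fixes-support J x (supp x Sx) i)) (πx≗y i)

  -- without function extensionality, closedness is what makes S respect pointwise equality
  Closed⇒¬¬-resp-≗ : ∀ {S x y} → Closed S → x ≗ y → S x → ¬ ¬ S y
  Closed⇒¬¬-resp-≗ {x = x} {y} closed x≗y Sx ¬Sy with closed y ¬Sy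
  ... | _ , nbhd = nbhd x (λ i _ → x≗y i) Sx

module OrdinalProperties (I Ω : WellOrder) (ι : Carrier I → Carrier Ω)
  (mono : Ordinals.StrictMono I Ω ι) where
  open Cube I
  open CubeProperties I
  open Ordinals I Ω ι
  open WellOrder Ω using () renaming (_<_ to _<Ω_; _<?_ to _<Ω?_)

  Below : Carrier Ω → Carrier I → Set
  Below ν i = ι i <Ω ν

  <Ω-trans : ∀ {a b c} → a <Ω b → b <Ω c → a <Ω c
  <Ω-trans = IsStrictTotalOrder.trans (WellOrder.isSTO Ω)

  Below-downClosed : ∀ ν → DownClosed (Below ν)
  Below-downClosed ν i<j ιj<ν = <Ω-trans (mono i<j) ιj<ν

  Below-mono : ∀ {ν ν′ i} → ν <Ω ν′ → Below ν i → Below ν′ i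
  Below-mono ν<ν′ ιi<ν = <Ω-trans ιi<ν ν<ν′

  Below⇒below : ∀ {ν i} → Below ν i → below ν i ≡ true
  Below⇒below {ν} {i} = dec-true (ι i <Ω? ν)

  below⇒Below : ∀ {ν i} → below ν i ≡ true → Below ν i
  below⇒Below {ν} {i} with ι i <Ω? ν
  ... | yes ιi<ν = λ _ → ιi<ν
  ... | no  _    = λ ()

  ev-πν : ∀ {ν} p → All (Below ν) p → ∀ x → ev p (πν ν x) ≡ ev p x
  ev-πν {ν} p Pp = ev-cong p Pp ∘ π-agree (below ν) (λ _ → Below⇒below)

  E-Sν-Below : ∀ ν S p → E (Sν ν S) p → All (Below ν) p
  E-Sν-Below ν S []       _          = []
  E-Sν-Below ν S (j ∷ ps) Ep@(d , _) =
    Decreasing⇒All (Below-downClosed ν) j ps d (below⇒Below (E-img-head (below ν) S j ps Ep))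

  E-Sν-transfer : ∀ {ν ν₁ ν₂ S p} →
    (∀ {i} → Below ν i → Below ν₁ i) → (∀ {i} → Below ν i → Below ν₂ i) →
    All (Below ν) p → E (Sν ν₁ S) p → E (Sν ν₂ S) p
  E-Sν-transfer {ν} {ν₁} {ν₂} {S} ν⊆ν₁ ν⊆ν₂ Pp =
    E-transfer (Below-downClosed ν) Pp
      (Covers-trans (img-covers (below ν₁) S (λ _ → Below⇒below ∘ ν⊆ν₁))
                    (covers-img (below ν₂) S (λ _ → Below⇒below ∘ ν⊆ν₂)))

  Below-limit : ∀ {μ} → IsLimit μ → ∀ p → Decreasing p → All (Below μ) p →
    ∃ λ ν → ν <Ω μ × All (Below ν) p
  Below-limit ((ν , ν<μ) , _) []       _ _          = ν , ν<μ , []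
  Below-limit (_ , between)   (j ∷ ps) d (ιj<μ ∷ _) with between (ι j) ιj<μ
  ... | ν , ιj<ν , ν<μ = ν , ν<μ , Decreasing⇒All (Below-downClosed ν) j ps d ιj<ν

lemma4p17 : (I Ω : WellOrder) (ι : Carrier I → Carrier Ω) →
    Ordinals.StrictMono I Ω ι → Ordinals.DownClosedImage I Ω ι →
    (μ : Carrier Ω) → Ordinals.IsLimit I Ω ι μ →
    (S : Cube.SubX I) → Cube.Closed I S →
    (∀ x → S x → ∀ i → x i ≡ true → WellOrder._<_ Ω (ι i) μ) →
    (f : Cube.X I → ℤ) →
      (Cube.InEvE I (Ordinals.Sν I Ω ι μ S) f →
        ∃ λ μ′ → WellOrder._<_ Ω μ′ μ × ∃ λ p →
          Cube.E I (Ordinals.Sν I Ω ι μ′ S) p ×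
          (∀ x → S x → f x ≡ Cube.ev I p (Ordinals.πν I Ω ι μ′ x)))
      ×
      ((∃ λ μ′ → WellOrder._<_ Ω μ′ μ × ∃ λ p →
          Cube.E I (Ordinals.Sν I Ω ι μ′ S) p ×
          (∀ x → S x → f x ≡ Cube.ev I p (Ordinals.πν I Ω ι μ′ x))) →
        Cube.InEvE I (Ordinals.Sν I Ω ι μ S) f)
lemma4p17 I Ω ι mono _ μ limit S closed supp f = restrict , extend
  where
  open Cube I
  open CubeProperties I
  open Ordinals I Ω ι
  open OrdinalProperties I Ω ι mono
  open WellOrder Ω using () renaming (_<_ to _<Ω_)

  InEvE-below : Set
  InEvE-below = ∃ λ ν → ν <Ω μ × ∃ λ p → E (Sν ν S) p × (∀ x → S x → f x ≡ ev p (πν ν x))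

  suppμ : Supported (below μ) S
  suppμ x Sx i = Below⇒below ∘ supp x Sx i

  restrict : InEvE (Sν μ S) f → InEvE-below
  restrict (p , Ep@(d , _) , f≡ev) with Below-limit limit p d (E-Sν-Below μ S p Ep)
  ... | ν , ν<μ , Pp = ν , ν<μ , p , E-Sν-transfer (Below-mono ν<μ) id Pp Ep ,
    λ x Sx → trans (f≡ev x (Supported⇒⊆img suppμ x Sx)) (sym (ev-πν p Pp x))

  extend : InEvE-below → InEvE (Sν μ S) f
  extend (ν , ν<μ , p , Ep , f≡ev) = p , E-Sν-transfer id (Below-mono ν<μ) Pp Ep , f≡ev′
    where
    Pp : All (Below ν) p
    Pp = E-Sν-Below ν S p Ep
    f≡ev′ : ∀ y → Sν μ S y → f y ≡ ev p y
    f≡ev′ y Sμy with Supported⇒img⊆≗ suppμ y Sμy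
    ... | x , Sx , x≗y = decidable-stable (f y ≟ ev p y) λ f≢ev →
      Closed⇒¬¬-resp-≗ closed x≗y Sx λ Sy → f≢ev (trans (f≡ev y Sy) (ev-πν p Pp y))
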